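{- The equation $t_p^2 + t_q^2 = t_r^2 + t_s^2$ has infinitely many non-trivial solutions in integers $p, q, r, s$.
   Context: For an integer $n$, $t_n = \frac{n(n+1)}{2}$. A solution is non-trivial if the multiset $\{t_p^2, t_q^2\}$ differs from the multiset $\{t_r^2, t_s^2\}$. -}

module Defs where

open import Data.Integer using (ℤ; _*_; _+_; +_)
open import Data.Integer.DivMod using (_/_)
open import Data.Product using (_×_)
open import Data.Sum using (_⊎_)
open import Relation.Binary.PropositionalEquality using (_≡_)
open import Relation.Nullary using (¬_)

t : ℤ → ℤ
t n = (n * (n + + 1)) / (+ 2)

SameMultiset : ℤ → ℤ → ℤ → ℤ → Set
SameMultiset a b c d = (a ≡ c × b ≡ d) ⊎ (a ≡ d × b ≡ c)

NontrivialSolution : ℤ → ℤ → ℤ → ℤ → Set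
NontrivialSolution p q r s =
  (t p * t p + t q * t q ≡ t r * t r + t s * t s)
  × ¬ SameMultiset (t p * t p) (t q * t q) (t r * t r) (t s * t s)

module Submission where

-- Write X = 2p + 1, so that 8 t_p = X² − 1.  Expanding gives
--   ((3σ+δ)²−1)² + ((2σ−3δ)²−1)² − ((3σ−δ)²−1)² − ((2σ+3δ)²−1)²
--     = 24 σ δ (σ² − 17δ² + 1),
-- so every solution of the negative Pell equation σ² − 17δ² = −1 yields a
-- solution of t_p² + t_q² = t_r² + t_s² with 2p+1 = 3σ+δ, 2q+1 = 2σ−3δ,
-- 2r+1 = 3σ−δ, 2s+1 = 2σ+3δ.  We use the Pell solutions
-- σ + δ√17 = (4 + √17)(33 + 8√17)ⁿ.  Each has σ = 2a even, δ = 2b+1 odd and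
-- a ≥ 2b+2, so we record it by the naturals b and c = a − 2b − 2; in these
-- coordinates p, q, r, s and multiplication by the unit 33 + 8√17 are linear
-- with nonnegative coefficients, and the whole argument runs in ℕ.

open import Defs
open import Data.Nat using (ℕ; _≤_; _⊔_)
open import Data.Integer using (ℤ; ∣_∣)
open import Data.Product using (Σ; _×_)

open import Data.Nat using (zero; suc; _+_; _*_; _<_; z≤n; s≤s; z<s)
open import Data.Nat.Properties
open import Data.Nat.DivMod using (m*n/n≡m) renaming (_/_ to _ℕ/_)
open import Data.Nat.Tactic.RingSolver using (solve-∀)
open import Data.Integer using (+_) renaming (_+_ to _+ℤ_; _*_ to _*ℤ_)
import Data.Integer.Properties as ℤₚ
open import Data.Integer.DivMod using (_/_; div-pos-is-/ℕ)
open import Data.Product using (_,_)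
open import Data.Sum using (inj₁; inj₂)
open import Relation.Nullary using (¬_)
open import Relation.Binary.PropositionalEquality
  using (_≡_; _≢_; refl; sym; trans; cong; cong₂; subst; subst₂; module ≡-Reasoning)

tri : ℕ → ℕ
tri zero    = zero
tri (suc n) = suc n + tri n

pronic : ℕ → ℕ
pronic n = n * (n + 1)

tri-double : ∀ n → tri n * 2 ≡ pronic n
tri-double zero    = refl
tri-double (suc n) = begin
  (suc n + tri n) * 2      ≡⟨ *-distribʳ-+ 2 (suc n) (tri n) ⟩
  suc n * 2 + tri n * 2    ≡⟨ cong (_+_ (suc n * 2)) (tri-double n) ⟩
  suc n * 2 + n * (n + 1)  ≡⟨ pronic-step n ⟩
  suc n * (suc n + 1)      ∎
  where
  open ≡-Reasoning
  pronic-step : ∀ n → suc n * 2 + n * (n + 1) ≡ suc n * (suc n + 1)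
  pronic-step = solve-∀

t-tri : ∀ n → t (+ n) ≡ + tri n
t-tri n = begin
  (+ n *ℤ (+ n +ℤ + 1)) / + 2  ≡⟨ cong (_/ + 2) (sym (ℤₚ.pos-* n (n + 1))) ⟩
  + pronic n / + 2             ≡⟨ cong (λ k → + k / + 2) (sym (tri-double n)) ⟩
  + (tri n * 2) / + 2          ≡⟨ div-pos-is-/ℕ (+ (tri n * 2)) 2 ⟩
  + (tri n * 2 ℕ/ 2)           ≡⟨ cong +_ (m*n/n≡m (tri n) 2) ⟩
  + tri n                      ∎
  where open ≡-Reasoning

tri-strict : ∀ {m n} → m < n → tri m < tri n
tri-strict {m} {n} m<n = *-cancelʳ-< 2 (tri m) (tri n)
  (subst₂ _<_ (sym (tri-double m)) (sym (tri-double n))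
    (*-mono-< m<n (+-monoˡ-< 1 m<n)))

-- At natural arguments the squares of t are squares of triangular numbers,
-- which lets the equation be proved in ℕ.
t²-tri : ∀ n → t (+ n) *ℤ t (+ n) ≡ + (tri n * tri n)
t²-tri n rewrite t-tri n = sym (ℤₚ.pos-* (tri n) (tri n))

t²-sum : ∀ m n → t (+ m) *ℤ t (+ m) +ℤ t (+ n) *ℤ t (+ n) ≡ + (tri m * tri m + tri n * tri n)
t²-sum m n = cong₂ _+ℤ_ (t²-tri m) (t²-tri n)

t²-injective : ∀ {m n} → n < m → t (+ m) *ℤ t (+ m) ≢ t (+ n) *ℤ t (+ n)
t²-injective {m} {n} n<m e = <⇒≢ (*-mono-< tn<tm tn<tm)
  (sym (ℤₚ.+-injective (trans (sym (t²-tri m)) (trans e (t²-tri n)))))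
  where
  tn<tm : tri n < tri m
  tn<tm = tri-strict n<m

σ : ℕ → ℕ → ℕ
σ b c = 2 * (c + 2 * b + 2)

δ : ℕ → ℕ
δ b = 2 * b + 1

IsPell : ℕ → ℕ → Set
IsPell b c = σ b c * σ b c + 1 ≡ 17 * (δ b * δ b)

record PellPoint : Set where
  constructor pellPoint
  field
    b c    : ℕ
    isPell : IsPell b c

-- The unit 33 + 8√17 has norm 33² − 17·8² = 1, so multiplying by it
-- preserves the norm form σ² − 17δ².
unit-norm : ∀ s d →
  (33 * s + 136 * d) * (33 * s + 136 * d) + 17 * (d * d)
  ≡ s * s + 17 * ((8 * s + 33 * d) * (8 * s + 33 * d))
unit-norm = solve-∀

unit-preserves-pell : ∀ s d → s * s + 1 ≡ 17 * (d * d) →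
  (33 * s + 136 * d) * (33 * s + 136 * d) + 1
  ≡ 17 * ((8 * s + 33 * d) * (8 * s + 33 * d))
unit-preserves-pell s d pell = +-cancelʳ-≡ (s * s) (s′² + 1) (17 * d′²) (begin
  (s′² + 1) + s * s      ≡⟨ +-assoc s′² 1 (s * s) ⟩
  s′² + (1 + s * s)      ≡⟨ cong (_+_ s′²) (+-comm 1 (s * s)) ⟩
  s′² + (s * s + 1)      ≡⟨ cong (_+_ s′²) pell ⟩
  s′² + 17 * (d * d)     ≡⟨ unit-norm s d ⟩
  s * s + 17 * d′²       ≡⟨ +-comm (s * s) (17 * d′²) ⟩
  17 * d′² + s * s       ∎)
  where
  open ≡-Reasoning
  s′² d′² : ℕ
  s′² = (33 * s + 136 * d) * (33 * s + 136 * d)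
  d′² = (8 * s + 33 * d) * (8 * s + 33 * d)

-- Multiplication by the unit in the (b, c) coordinates; the coefficients
-- are nonnegative, so the step stays inside ℕ.
next-b next-c : ℕ → ℕ → ℕ
next-b b c = 8 * c + 49 * b + 32
next-c b c = 17 * c + 104 * b + 68

σ-next : ∀ b c → σ (next-b b c) (next-c b c) ≡ 33 * σ b c + 136 * δ b
σ-next = linear
  where
  linear : ∀ b c →
    2 * ((17 * c + 104 * b + 68) + 2 * (8 * c + 49 * b + 32) + 2)
    ≡ 33 * (2 * (c + 2 * b + 2)) + 136 * (2 * b + 1)
  linear = solve-∀

δ-next : ∀ b c → δ (next-b b c) ≡ 8 * σ b c + 33 * δ b
δ-next = linear
  where
  linear : ∀ b c →
    2 * (8 * c + 49 * b + 32) + 1 ≡ 8 * (2 * (c + 2 * b + 2)) + 33 * (2 * b + 1)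
  linear = solve-∀

next-isPell : ∀ b c → IsPell b c → IsPell (next-b b c) (next-c b c)
next-isPell b c pell =
  subst₂ (λ s d → s * s + 1 ≡ 17 * (d * d)) (sym (σ-next b c)) (sym (δ-next b c))
    (unit-preserves-pell (σ b c) (δ b) pell)

next : PellPoint → PellPoint
next (pellPoint b c pell) = pellPoint (next-b b c) (next-c b c) (next-isPell b c pell)

-- The n-th Pell point: (σ, δ) = (4 + √17)^(2n+1), starting from (4, 1).
pell-point : ℕ → PellPoint
pell-point zero    = pellPoint 0 0 refl
pell-point (suc n) = next (pell-point n)

b<next-b : ∀ b c → b < next-b b c
b<next-b b c = begin-strict
  b                    ≤⟨ m≤n*m b 49 ⟩
  49 * b               ≤⟨ m≤n+m (49 * b) (8 * c) ⟩
  8 * c + 49 * b       <⟨ m<m+n (8 * c + 49 * b) z<s ⟩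
  8 * c + 49 * b + 32  ∎
  where open ≤-Reasoning

pell-point-grows : ∀ n → n ≤ PellPoint.b (pell-point n)
pell-point-grows zero    = z≤n
pell-point-grows (suc n) with pell-point n | pell-point-grows n
... | pellPoint b c _ | n≤b = <-≤-trans (s≤s n≤b) (b<next-b b c)

-- The solution attached to the Pell point (b, c): in terms of σ and δ these are
-- 2p+1 = 3σ+δ, 2q+1 = 2σ−3δ, 2r+1 = 3σ−δ, 2s+1 = 2σ+3δ.
p-of q-of r-of s-of : ℕ → ℕ → ℕ
p-of b c = 3 * c + 7 * b + 6
q-of b c = 2 * c + b + 2
r-of b c = 3 * c + 5 * b + 5
s-of b c = 2 * c + 7 * b + 5

-- The quartic identity: with a = σ/2,
--   (p(p+1))² + (q(q+1))² − (r(r+1))² − (s(s+1))² = 3aδ (σ² + 1 − 17δ²),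
-- written without subtraction.
quartic-identity : ∀ b c → let K = 3 * (c + 2 * b + 2) * δ b in
  pronic (p-of b c) * pronic (p-of b c) + pronic (q-of b c) * pronic (q-of b c)
    + K * (17 * (δ b * δ b))
  ≡ pronic (r-of b c) * pronic (r-of b c) + pronic (s-of b c) * pronic (s-of b c)
    + K * (σ b c * σ b c + 1)
quartic-identity = polynomial
  where
  polynomial : ∀ b c →
    ((3 * c + 7 * b + 6) * ((3 * c + 7 * b + 6) + 1)) * ((3 * c + 7 * b + 6) * ((3 * c + 7 * b + 6) + 1))
    + ((2 * c + b + 2) * ((2 * c + b + 2) + 1)) * ((2 * c + b + 2) * ((2 * c + b + 2) + 1))
    + 3 * (c + 2 * b + 2) * (2 * b + 1) * (17 * ((2 * b + 1) * (2 * b + 1)))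
    ≡ ((3 * c + 5 * b + 5) * ((3 * c + 5 * b + 5) + 1)) * ((3 * c + 5 * b + 5) * ((3 * c + 5 * b + 5) + 1))
    + ((2 * c + 7 * b + 5) * ((2 * c + 7 * b + 5) + 1)) * ((2 * c + 7 * b + 5) * ((2 * c + 7 * b + 5) + 1))
    + 3 * (c + 2 * b + 2) * (2 * b + 1) * ((2 * (c + 2 * b + 2)) * (2 * (c + 2 * b + 2)) + 1)
  polynomial = solve-∀

-- At a Pell point σ² + 1 = 17δ², so the two correction terms of the quartic
-- identity coincide and cancel.
pronic-equation : ∀ b c → IsPell b c →
  pronic (p-of b c) * pronic (p-of b c) + pronic (q-of b c) * pronic (q-of b c)
  ≡ pronic (r-of b c) * pronic (r-of b c) + pronic (s-of b c) * pronic (s-of b c)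
pronic-equation b c pell = +-cancelʳ-≡ (K * (17 * (δ b * δ b))) _ _
  (trans (quartic-identity b c) (cong (λ x → rhs + K * x) pell))
  where
  K rhs : ℕ
  K   = 3 * (c + 2 * b + 2) * δ b
  rhs = pronic (r-of b c) * pronic (r-of b c) + pronic (s-of b c) * pronic (s-of b c)

tri²-sum : ∀ m n →
  (tri m * tri m + tri n * tri n) * 4 ≡ pronic m * pronic m + pronic n * pronic n
tri²-sum m n = begin
  (tri m * tri m + tri n * tri n) * 4
    ≡⟨ doubled-squares (tri m) (tri n) ⟩
  (tri m * 2) * (tri m * 2) + (tri n * 2) * (tri n * 2)
    ≡⟨ cong₂ (λ x y → x * x + y * y) (tri-double m) (tri-double n) ⟩
  pronic m * pronic m + pronic n * pronic n
    ∎
  where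
  open ≡-Reasoning
  doubled-squares : ∀ x y → (x * x + y * y) * 4 ≡ (x * 2) * (x * 2) + (y * 2) * (y * 2)
  doubled-squares = solve-∀

tri-equation : ∀ b c → IsPell b c →
  tri (p-of b c) * tri (p-of b c) + tri (q-of b c) * tri (q-of b c)
  ≡ tri (r-of b c) * tri (r-of b c) + tri (s-of b c) * tri (s-of b c)
tri-equation b c pell = *-cancelʳ-≡ _ _ 4 (begin
  (tri p * tri p + tri q * tri q) * 4      ≡⟨ tri²-sum p q ⟩
  pronic p * pronic p + pronic q * pronic q  ≡⟨ pronic-equation b c pell ⟩
  pronic r * pronic r + pronic s * pronic s  ≡⟨ sym (tri²-sum r s) ⟩
  (tri r * tri r + tri s * tri s) * 4      ∎)
  where
  open ≡-Reasoning
  p q r s : ℕ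
  p = p-of b c
  q = q-of b c
  r = r-of b c
  s = s-of b c

-- p exceeds r and s, which makes the solution non-trivial.
r<p : ∀ b c → r-of b c < p-of b c
r<p b c = subst (r-of b c <_) (sym (p≡r+ b c)) (m<m+n (r-of b c) z<s)
  where
  p≡r+ : ∀ b c → 3 * c + 7 * b + 6 ≡ (3 * c + 5 * b + 5) + suc (2 * b)
  p≡r+ = solve-∀

s<p : ∀ b c → s-of b c < p-of b c
s<p b c = subst (s-of b c <_) (sym (p≡s+ b c)) (m<m+n (s-of b c) z<s)
  where
  p≡s+ : ∀ b c → 3 * c + 7 * b + 6 ≡ (2 * c + 7 * b + 5) + suc c
  p≡s+ = solve-∀

pell-solution : ∀ b c → IsPell b c →
  NontrivialSolution (+ p-of b c) (+ q-of b c) (+ r-of b c) (+ s-of b c)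
pell-solution b c pell = equation , nontrivial
  where
  equation : t (+ p-of b c) *ℤ t (+ p-of b c) +ℤ t (+ q-of b c) *ℤ t (+ q-of b c)
           ≡ t (+ r-of b c) *ℤ t (+ r-of b c) +ℤ t (+ s-of b c) *ℤ t (+ s-of b c)
  equation = trans (t²-sum (p-of b c) (q-of b c))
               (trans (cong +_ (tri-equation b c pell)) (sym (t²-sum (r-of b c) (s-of b c))))
  nontrivial : ¬ SameMultiset (t (+ p-of b c) *ℤ t (+ p-of b c)) (t (+ q-of b c) *ℤ t (+ q-of b c))
                              (t (+ r-of b c) *ℤ t (+ r-of b c)) (t (+ s-of b c) *ℤ t (+ s-of b c))
  nontrivial (inj₁ (tp²≡tr² , _)) = t²-injective (r<p b c) tp²≡tr²
  nontrivial (inj₂ (tp²≡ts² , _)) = t²-injective (s<p b c) tp²≡ts²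

b≤p : ∀ b c → b ≤ p-of b c
b≤p b c = begin
  b                  ≤⟨ m≤n*m b 7 ⟩
  7 * b              ≤⟨ m≤n+m (7 * b) (3 * c) ⟩
  3 * c + 7 * b      ≤⟨ m≤m+n (3 * c + 7 * b) 6 ⟩
  3 * c + 7 * b + 6  ∎
  where open ≤-Reasoning

theorem5p3 : (N : ℕ) → Σ ℤ λ p → Σ ℤ λ q → Σ ℤ λ r → Σ ℤ λ s → NontrivialSolution p q r s × N ≤ ∣ p ∣ ⊔ ∣ q ∣ ⊔ ∣ r ∣ ⊔ ∣ s ∣
theorem5p3 N with pell-point N | pell-point-grows N
... | pellPoint b c pell | N≤b =
  + p , + q , + r , + s , pell-solution b c pell , N≤max
  where
  p q r s : ℕ
  p = p-of b c
  q = q-of b c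
  r = r-of b c
  s = s-of b c
  N≤max : N ≤ p ⊔ q ⊔ r ⊔ s
  N≤max = ≤-trans N≤b (≤-trans (b≤p b c) (m≤n⇒m≤n⊔o s (m≤n⇒m≤n⊔o r (m≤m⊔n p q))))
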